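{- (i) Let $\eta_1,\eta_2$ be compositions with positive parts, of sizes $n_1,n_2$, and let $\gamma_1\in Y_{\eta_1}$, $\gamma_2\in Y_{\eta_2}$. Then $K_{\Phi(\eta_1*\eta_2)}(\gamma_1*\gamma_2\mid q)=K_{\Phi(\eta_1)}(\gamma_1\mid q)\,K_{\Phi(\eta_2)}(\gamma_2\mid q)$. (ii) Let $\eta$ be a composition of $n$ with positive parts and $\gamma\in Y_\eta$. Then $K_{\Phi(\eta)}(\gamma\mid q)=K_{\Phi(\overleftarrow{\eta})}(-\overleftarrow{\gamma}\mid q)$. (iii) Let $\eta_1,\eta_2$ be compositions of $n$ with positive parts such that $\eta_2$ is a subdivision of $\eta_1$, and let $\gamma\in\mathbb{Z}^n$ with $\sum\gamma_i=0$. Then $K_{\Phi(\eta_2)}(\gamma\mid q)-K_{\Phi(\eta_1)}(\gamma\mid q)$ is a polynomial with non-negative coefficients.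
   Context: For a composition $\theta=(\theta_1,\dots,\theta_p)$ of $n$ with positive parts, $r_k=\theta_1+\cdots+\theta_k$, $r_0=0$, $\Phi(\theta)=\{(i,j):1\le i\le r_k<j\le n\text{ for some }k\}$; for $\gamma\in\mathbb{Z}^n$ with $\sum\gamma_i=0$, $K_{\Phi(\theta)}(\gamma\mid q)$ is the coefficient of $x^\gamma$ in $\prod_{(i,j)\in\Phi(\theta)}(1-qx_i/x_j)^{ -1}$ expanded as geometric series in $x_i/x_j$. $Y_\theta$ is the set of $\gamma\in\mathbb{Z}^n$ with $\sum\gamma_i=0$ such that for each $0\le k\le p-1$ and every $\Omega\subseteq\{r_k+1,\dots,r_{k+1}\}$, $\sum_{j\le r_k}\gamma_j+\sum_{a\in\Omega}\gamma_a\ge0$. $*$ denotes concatenation of sequences. For a sequence $\beta=(\beta_1,\dots,\beta_r)$, $\overleftarrow\beta=(\beta_r,\dots,\beta_1)$. $\eta_2$ is a subdivision of $\eta_1=(\eta_{1,1},\dots,\eta_{1,p})$ if there are partitions $\mu^{(1)},\dots,\mu^{(p)}$ (with positive parts) with $|\mu^{(j)}|=\eta_{1,j}$ and $\eta_2=\mu^{(1)}*\cdots*\mu^{(p)}$. -}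

module Defs where

open import Data.Bool using (Bool; true; false; _∧_; if_then_else_)
open import Data.Nat as ℕ using (ℕ; zero; suc; _+_; _*_; _∸_; _≤_; _<_; _≤ᵇ_; _<ᵇ_; _≡ᵇ_)
open import Data.Integer as ℤ using (ℤ; +_; -_)
open import Data.Product using (_×_; _,_; Σ; ∃)
open import Data.Fin using (Fin)
open import Data.List using (List; []; _∷_; map; concatMap; upTo; filter; filterᵇ; length; take; drop; lookup; concat)
open import Data.Nat.ListAction using (sum)
open import Data.Bool.ListAction using (any)
open import Data.List.Properties using (≡-dec)
open import Data.List.Relation.Unary.All using (All)
open import Data.List.Relation.Unary.Linked using (Linked)
open import Data.List.Relation.Binary.Pointwise using (Pointwise)
open import Data.List.Relation.Binary.Sublist.Propositional using (_⊆_)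
open import Relation.Binary.PropositionalEquality using (_≡_)

sumℤ : List ℤ → ℤ
sumℤ [] = + 0
sumℤ (x ∷ xs) = x ℤ.+ sumℤ xs

IsComposition : List ℕ → Set
IsComposition θ = All (λ x → 0 < x) θ

IsPartition : List ℕ → Set
IsPartition μ = All (λ x → 0 < x) μ × Linked ℕ._≥_ μ

positions : ℕ → List ℕ
positions n = map suc (upTo n)

pairs : ℕ → List (ℕ × ℕ)
pairs n = concatMap (λ i → map (λ t → (i , suc i + t)) (upTo (n ∸ i))) (positions n)

psums : ℕ → List ℕ → List ℕ
psums acc [] = []
psums acc (x ∷ xs) = (acc + x) ∷ psums (acc + x) xs

-- (i , j) ∈ Φ(θ)  iff  i ≤ r_k < j for some k (r_0 = 0 never qualifies since i ≥ 1)
inPhi : List ℕ → ℕ × ℕ → Bool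
inPhi θ (i , j) = any (λ r → (i ≤ᵇ r) ∧ (r <ᵇ j)) (psums 0 θ)

Phi : List ℕ → List (ℕ × ℕ)
Phi θ = filterᵇ (inPhi θ) (pairs (sum θ))

-- all lists of L naturals with total d  (exponent vectors m : Φ → ℕ of total degree d)
comps : ℕ → ℕ → List (List ℕ)
comps zero zero = [] ∷ []
comps zero (suc d) = []
comps (suc L) d = concatMap (λ a → map (a ∷_) (comps L (d ∸ a))) (upTo (suc d))

-- the a-th coordinate of  Σ_{(i,j)} m_{ij} (e_i - e_j)
net : List (ℕ × ℕ) → List ℕ → ℕ → ℤ
net ((i , j) ∷ ps) (m ∷ ms) a =
  ((if i ≡ᵇ a then + m else + 0) ℤ.- (if j ≡ᵇ a then + m else + 0)) ℤ.+ net ps ms a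
net _ _ a = + 0

weight : List ℕ → List ℕ → List ℤ
weight θ m = map (net (Phi θ) m) (positions (sum θ))

-- K_{Φ(θ)}(γ | q), as its coefficient sequence: the coefficient of q^d x^γ in
-- ∏_{(i,j)∈Φ(θ)} Σ_{m≥0} q^m (x_i/x_j)^m, i.e. the number of m : Φ(θ) → ℕ with
-- Σ m = d and Σ m_{ij}(e_i - e_j) = γ.
K : List ℕ → List ℤ → ℕ → ℕ
K θ γ d = length (filter (λ m → ≡-dec ℤ._≟_ (weight θ m) γ) (comps (length (Phi θ)) d))

-- coefficients of a product of two polynomials (Cauchy product)
conv : (ℕ → ℕ) → (ℕ → ℕ) → ℕ → ℕ
conv f g d = sum (map (λ a → f a * g (d ∸ a)) (upTo (suc d)))

InY : List ℕ → List ℤ → Set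
InY θ γ =
  length γ ≡ sum θ × sumℤ γ ≡ + 0 ×
  ((k : Fin (length θ)) → (Ω : List ℤ) →
     Ω ⊆ take (lookup θ k) (drop (sum (take (Data.Fin.toℕ k) θ)) γ) →
     + 0 ℤ.≤ sumℤ (take (sum (take (Data.Fin.toℕ k) θ)) γ) ℤ.+ sumℤ Ω)

IsSubdivision : List ℕ → List ℕ → Set
IsSubdivision η₂ η₁ =
  Σ (List (List ℕ)) λ μs →
    Pointwise (λ μ a → IsPartition μ × sum μ ≡ a) μs η₁ × η₂ ≡ concat μs

-- K_Φ(γ | q) depends only on the multiset Φ: expanding the product one root at a time, two
-- adjacent roots can be exchanged because that only reorders a double sum over a triangle.
-- (iii) Refining a composition only adds cut points, so Φ(η₁) ⊆ Φ(η₂), and extra roots can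
-- only add exponent vectors.
-- (ii) The reflection (i , j) ↦ (n+1-j , n+1-i) maps Φ(η) onto Φ(reverse η) and turns the
-- weight of every exponent vector into its reversed negative.
-- (i) Φ(η₁ * η₂) consists of Φ(η₁), Φ(η₂) shifted by n₁ = |η₁|, and the pairs crossing the
-- cut at n₁.  The first n₁ coordinates of a weight sum to the total exponent on the crossing
-- pairs, which for γ₁ is Σγ₁ = 0; so those exponents vanish and the count is the Cauchy
-- product of the counts for the two blocks.

module Submission where

open import Algebra.Properties.CommutativeSemigroup using (interchange; xy∙z≈xz∙y)
open import Data.Bool using (T; T?; true; false; if_then_else_)
open import Data.Bool.Properties using (T-∧)
open import Data.Empty using (⊥-elim)
open import Data.Integer using (ℤ; -_)
open import Data.Integer as ℤ using (0ℤ)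
import Data.Integer.Properties as ℤ
open import Data.Integer.Tactic.RingSolver using (solve-∀)
open import Data.List
  using (List; []; _∷_; _++_; [_]; map; filter; concat; concatMap; length; applyUpTo; upTo; replicate; take; reverse)
open import Data.List.Membership.Propositional using (_∈_; find; lose)
open import Data.List.Membership.Propositional.Properties
  using (∈-map⁺; ∈-map⁻; ∈-upTo⁺; ∈-upTo⁻; ∈-concatMap⁺; ∈-concatMap⁻; ∈-filter⁺; ∈-filter⁻; ∈-++⁺ˡ; ∈-++⁺ʳ; ∈-++⁻)
open import Data.List.Membership.Propositional.Properties.WithK using (unique∧set⇒bag)
open import Data.List.Properties
  using ( ≡-dec; ∷-injective; length-++; length-map; length-upTo; map-cong; map-cong-local; map-id; map-id-local; map-∘
        ; map-++; map-upTo; upTo-∷ʳ; ++-assoc; ++-identityʳ; filter-≐; filter-++; filter-none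
        ; reverse-++; reverse-map; reverse-involutive; unfold-reverse )
open import Data.List.Relation.Binary.BagAndSetEquality using (∼bag⇒↭)
open import Data.List.Relation.Binary.Disjoint.Propositional using (Disjoint)
open import Data.List.Relation.Binary.Permutation.Propositional as ↭ using (_↭_)
open import Data.List.Relation.Binary.Permutation.Propositional.Properties using (↭-reverse)
open import Data.List.Relation.Binary.Pointwise as Pointwise using (Pointwise; []; _∷_)
open import Data.List.Relation.Binary.Sublist.Propositional using (_⊆_; []; _∷ʳ_; _∷_; ⊆-refl)
open import Data.List.Relation.Binary.Sublist.Propositional.Properties using (filter⁺)
open import Data.List.Relation.Unary.All as All using (All; []; _∷_)
import Data.List.Relation.Unary.All.Properties as Allₚ
open import Data.List.Relation.Unary.AllPairs as AllPairs using (AllPairs)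
import Data.List.Relation.Unary.AllPairs.Properties as AllPairs
open import Data.List.Relation.Unary.Any using (here; there)
open import Data.List.Relation.Unary.Any.Properties using (any⁺; any⁻; reverse⁺)
open import Data.List.Relation.Unary.Unique.Propositional using (Unique)
import Data.List.Relation.Unary.Unique.Propositional.Properties as Unique
open import Data.Nat using (ℕ; zero; suc; _+_; _*_; _∸_; _≤_; _<_; z≤n; s≤s; _≡ᵇ_; _≤?_; _<?_)
open import Data.Nat.ListAction using (sum)
open import Data.Nat.ListAction.Properties using (sum-↭; sum-++)
open import Data.Nat.Properties
open import Data.Product using (_×_; _,_; proj₁; proj₂; ∃)
open import Data.Sum using (_⊎_; inj₁; inj₂)
open import Function using (id; _∘_; _⇔_; Equivalence; mk⇔)
open import Level using (0ℓ)
open import Relation.Binary.PropositionalEquality hiding ([_])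
open import Relation.Nullary using (yes; no; ¬_; _×-dec_)
open import Relation.Unary using (Pred; Decidable; _≐_)

open import Defs

∑< : ℕ → (ℕ → ℕ) → ℕ
∑< zero    f = 0
∑< (suc n) f = f 0 + ∑< n (f ∘ suc)

∑<-cong-< : ∀ n {f g : ℕ → ℕ} → (∀ a → a < n → f a ≡ g a) → ∑< n f ≡ ∑< n g
∑<-cong-< zero    f≡g = refl
∑<-cong-< (suc n) f≡g = cong₂ _+_ (f≡g 0 (s≤s z≤n)) (∑<-cong-< n (λ a a<n → f≡g (suc a) (s≤s a<n)))

∑<-cong : ∀ n {f g : ℕ → ℕ} → f ≗ g → ∑< n f ≡ ∑< n g
∑<-cong n f≗g = ∑<-cong-< n (λ a _ → f≗g a)

∑<-+ : ∀ n f g → ∑< n (λ a → f a + g a) ≡ ∑< n f + ∑< n g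
∑<-+ zero    f g = refl
∑<-+ (suc n) f g =
  trans (cong ((f 0 + g 0) +_) (∑<-+ n (f ∘ suc) (g ∘ suc))) (interchange +-commutativeSemigroup (f 0) (g 0) _ _)

∑<-*ʳ : ∀ n c f → ∑< n (λ a → f a * c) ≡ ∑< n f * c
∑<-*ʳ zero    c f = refl
∑<-*ʳ (suc n) c f = trans (cong (f 0 * c +_) (∑<-*ʳ n c (f ∘ suc))) (sym (*-distribʳ-+ c (f 0) _))

∑<-mono-≤ : ∀ n {f g : ℕ → ℕ} → (∀ a → f a ≤ g a) → ∑< n f ≤ ∑< n g
∑<-mono-≤ zero    f≤g = z≤n
∑<-mono-≤ (suc n) f≤g = +-mono-≤ (f≤g 0) (∑<-mono-≤ n (f≤g ∘ suc))

∑<-0 : ∀ n {f : ℕ → ℕ} → (∀ a → f a ≡ 0) → ∑< n f ≡ 0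
∑<-0 zero    f≡0 = refl
∑<-0 (suc n) f≡0 = cong₂ _+_ (f≡0 0) (∑<-0 n (f≡0 ∘ suc))

∑<-last : ∀ n f → ∑< (suc n) f ≡ ∑< n f + f n
∑<-last zero    f = +-comm (f 0) 0
∑<-last (suc n) f = trans (cong (f 0 +_) (∑<-last n (f ∘ suc))) (sym (+-assoc (f 0) _ _))

∑<-reverse : ∀ n f → ∑< n f ≡ ∑< n (λ a → f (n ∸ suc a))
∑<-reverse zero    f = refl
∑<-reverse (suc n) f = begin
  f 0 + ∑< n (f ∘ suc)                   ≡⟨ cong (f 0 +_) (∑<-reverse n (f ∘ suc)) ⟩
  f 0 + ∑< n (λ a → f (suc (n ∸ suc a))) ≡⟨ cong (f 0 +_) (∑<-cong-< n (λ a a<n → cong f (sym (+-∸-assoc 1 a<n)))) ⟩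
  f 0 + ∑< n (λ a → f (n ∸ a))           ≡⟨ +-comm (f 0) _ ⟩
  ∑< n (λ a → f (n ∸ a)) + f 0           ≡⟨ cong (λ z → ∑< n (λ a → f (n ∸ a)) + f z) (n∸n≡0 n) ⟨
  ∑< n (λ a → f (n ∸ a)) + f (n ∸ n)     ≡⟨ ∑<-last n (λ a → f (n ∸ a)) ⟨
  ∑< (suc n) (λ a → f (n ∸ a))           ∎
  where open ≡-Reasoning

∑△ : ℕ → (ℕ → ℕ → ℕ) → ℕ
∑△ d F = ∑< (suc d) (λ a → ∑< (suc (d ∸ a)) (F a))

∑△-by-diagonals : ∀ d F → ∑< (suc d) (λ c → ∑< (suc c) (λ a → F a (c ∸ a))) ≡ ∑△ d F
∑△-by-diagonals zero    F = refl
∑△-by-diagonals (suc d) F = begin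
  (F 0 0 + 0) + ∑< (suc d) (λ c → F 0 (suc c) + ∑< (suc c) (λ a → F (suc a) (c ∸ a)))
    ≡⟨ cong (F 0 0 + 0 +_) (∑<-+ (suc d) (F 0 ∘ suc) (λ c → ∑< (suc c) (λ a → F (suc a) (c ∸ a)))) ⟩
  (F 0 0 + 0) + (∑< (suc d) (F 0 ∘ suc) + ∑< (suc d) (λ c → ∑< (suc c) (λ a → F (suc a) (c ∸ a))))
    ≡⟨ cong (λ z → F 0 0 + 0 + (∑< (suc d) (F 0 ∘ suc) + z)) (∑△-by-diagonals d (F ∘ suc)) ⟩
  (F 0 0 + 0) + (∑< (suc d) (F 0 ∘ suc) + ∑△ d (F ∘ suc))
    ≡⟨ cong (_+ (∑< (suc d) (F 0 ∘ suc) + ∑△ d (F ∘ suc))) (+-identityʳ (F 0 0)) ⟩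
  F 0 0 + (∑< (suc d) (F 0 ∘ suc) + ∑△ d (F ∘ suc))
    ≡⟨ +-assoc (F 0 0) _ _ ⟨
  (F 0 0 + ∑< (suc d) (F 0 ∘ suc)) + ∑△ d (F ∘ suc) ∎
  where open ≡-Reasoning

∑△-swap : ∀ d F → ∑△ d F ≡ ∑△ d (λ a b → F b a)
∑△-swap d F = begin
  ∑△ d F
    ≡⟨ ∑△-by-diagonals d F ⟨
  ∑< (suc d) (λ c → ∑< (suc c) (λ a → F a (c ∸ a)))
    ≡⟨ ∑<-cong (suc d) (λ c → ∑<-reverse (suc c) (λ a → F a (c ∸ a))) ⟩
  ∑< (suc d) (λ c → ∑< (suc c) (λ a → F (c ∸ a) (c ∸ (c ∸ a))))
    ≡⟨ ∑<-cong (suc d) (λ c → ∑<-cong-< (suc c) (λ a a≤c → cong (F (c ∸ a)) (m∸[m∸n]≡n (≤-pred a≤c)))) ⟩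
  ∑< (suc d) (λ c → ∑< (suc c) (λ a → F (c ∸ a) a))
    ≡⟨ ∑△-by-diagonals d (λ a b → F b a) ⟩
  ∑△ d (λ a b → F b a) ∎
  where open ≡-Reasoning

sum-map-applyUpTo : ∀ n (f g : ℕ → ℕ) → sum (map f (applyUpTo g n)) ≡ ∑< n (f ∘ g)
sum-map-applyUpTo zero    f g = refl
sum-map-applyUpTo (suc n) f g = cong (f (g 0) +_) (sum-map-applyUpTo n f (g ∘ suc))

module _ {A : Set} {P : Pred A 0ℓ} (P? : Decidable P) where

  count : List A → ℕ
  count xs = length (filter P? xs)

  count-++ : ∀ xs ys → count (xs ++ ys) ≡ count xs + count ys
  count-++ xs ys = trans (cong length (filter-++ P? xs ys)) (length-++ (filter P? xs))

  count-none : ∀ xs → (∀ x → ¬ P x) → count xs ≡ 0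
  count-none xs ¬P = cong length (filter-none P? {xs} (All.tabulate (λ {x} _ → ¬P x)))

  count-concatMap-applyUpTo : ∀ n (g : ℕ → ℕ) (f : ℕ → List A) →
    count (concatMap f (applyUpTo g n)) ≡ ∑< n (λ a → count (f (g a)))
  count-concatMap-applyUpTo zero    g f = refl
  count-concatMap-applyUpTo (suc n) g f =
    trans (count-++ (f (g 0)) (concatMap f (applyUpTo (g ∘ suc) n)))
          (cong (count (f (g 0)) +_) (count-concatMap-applyUpTo n (g ∘ suc) f))

count-cong : ∀ {A : Set} {P Q : Pred A 0ℓ} (P? : Decidable P) (Q? : Decidable Q) → P ≐ Q →
  ∀ xs → count P? xs ≡ count Q? xs
count-cong P? Q? P≐Q xs = cong length (filter-≐ P? Q? P≐Q xs)

count-map : ∀ {A B : Set} {P : Pred B 0ℓ} (P? : Decidable P) (g : A → B) xs →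
  count P? (map g xs) ≡ count (P? ∘ g) xs
count-map P? g []       = refl
count-map P? g (x ∷ xs) with P? (g x)
... | yes _ = cong suc (count-map P? g xs)
... | no  _ = count-map P? g xs

count-comps-suc : ∀ {P : Pred (List ℕ) 0ℓ} (P? : Decidable P) L d →
  count P? (comps (suc L) d) ≡ ∑< (suc d) (λ a → count (P? ∘ (a ∷_)) (comps L (d ∸ a)))
count-comps-suc P? L d =
  trans (count-concatMap-applyUpTo P? (suc d) id (λ a → map (a ∷_) (comps L (d ∸ a))))
        (∑<-cong (suc d) (λ a → count-map P? (a ∷_) (comps L (d ∸ a))))

count-comps-zero-prefix : ∀ {P : Pred (List ℕ) 0ℓ} (P? : Decidable P) Lc L d →
  (∀ m → P m → All (_≡ 0) (take Lc m)) →
  count P? (comps (Lc + L) d) ≡ count (P? ∘ (replicate Lc 0 ++_)) (comps L d)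
count-comps-zero-prefix P? zero     L d prefix≡0 = refl
count-comps-zero-prefix P? (suc Lc) L d prefix≡0 = begin
  count P? (comps (suc (Lc + L)) d)
    ≡⟨ count-comps-suc P? (Lc + L) d ⟩
  count (P? ∘ (0 ∷_)) (comps (Lc + L) d) + ∑< d (λ b → count (P? ∘ (suc b ∷_)) (comps (Lc + L) (d ∸ suc b)))
    ≡⟨ cong₂ _+_ (count-comps-zero-prefix (P? ∘ (0 ∷_)) Lc L d (λ m p → All.tail (prefix≡0 (0 ∷ m) p)))
                 (∑<-0 d (λ b → count-none (P? ∘ (suc b ∷_)) (comps (Lc + L) (d ∸ suc b))
                                           (λ m p → 1+n≢0 (All.head (prefix≡0 (suc b ∷ m) p))))) ⟩
  count (P? ∘ (replicate (suc Lc) 0 ++_)) (comps L d) + 0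
    ≡⟨ +-identityʳ _ ⟩
  count (P? ∘ (replicate (suc Lc) 0 ++_)) (comps L d) ∎
  where open ≡-Reasoning

count-comps-++ : ∀ {P P₁ P₂ : Pred (List ℕ) 0ℓ} (P? : Decidable P) (P₁? : Decidable P₁) (P₂? : Decidable P₂) L₁ L₂ d →
  (∀ x y → length x ≡ L₁ → P (x ++ y) ⇔ (P₁ x × P₂ y)) →
  count P? (comps (L₁ + L₂) d) ≡ ∑< (suc d) (λ c → count P₁? (comps L₁ c) * count P₂? (comps L₂ (d ∸ c)))
count-comps-++ P? P₁? P₂? zero L₂ d split with P₁? []
... | yes p₁ = begin
  count P? (comps L₂ d)
    ≡⟨ count-cong P? P₂? ( (λ {y} p → proj₂ (Equivalence.to (split [] y refl) p))
                         , (λ {y} p₂ → Equivalence.from (split [] y refl) (p₁ , p₂)) ) (comps L₂ d) ⟩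
  count P₂? (comps L₂ d)
    ≡⟨ +-identityʳ _ ⟨
  count P₂? (comps L₂ d) + 0
    ≡⟨ cong₂ _+_ (+-identityʳ _) (∑<-0 d (λ _ → refl)) ⟨
  (count P₂? (comps L₂ d) + 0) + ∑< d (λ _ → 0) ∎
  where open ≡-Reasoning
... | no ¬p₁ = trans (count-none P? (comps L₂ d) (λ y p → ¬p₁ (proj₁ (Equivalence.to (split [] y refl) p))))
                     (sym (∑<-0 d (λ _ → refl)))
count-comps-++ {P₁ = P₁} P? P₁? P₂? (suc L₁) L₂ d split = begin
  count P? (comps (suc (L₁ + L₂)) d)
    ≡⟨ count-comps-suc P? (L₁ + L₂) d ⟩
  ∑< (suc d) (λ a → count (P? ∘ (a ∷_)) (comps (L₁ + L₂) (d ∸ a)))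
    ≡⟨ ∑<-cong (suc d) (λ a → count-comps-++ (P? ∘ (a ∷_)) (P₁? ∘ (a ∷_)) P₂? L₁ L₂ (d ∸ a)
                                 (λ x y |x| → split (a ∷ x) y (cong suc |x|))) ⟩
  ∑△ d F
    ≡⟨ ∑△-by-diagonals d F ⟨
  ∑< (suc d) (λ c → ∑< (suc c) (λ a → F a (c ∸ a)))
    ≡⟨ ∑<-cong (suc d) (λ c → ∑<-cong-< (suc c) (λ a a≤c →
         cong (λ e → C₁ a (c ∸ a) * C₂ e) (d∸a∸[c∸a] c a (≤-pred a≤c)))) ⟩
  ∑< (suc d) (λ c → ∑< (suc c) (λ a → C₁ a (c ∸ a) * C₂ (d ∸ c)))
    ≡⟨ ∑<-cong (suc d) (λ c → ∑<-*ʳ (suc c) (C₂ (d ∸ c)) (λ a → C₁ a (c ∸ a))) ⟩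
  ∑< (suc d) (λ c → ∑< (suc c) (λ a → C₁ a (c ∸ a)) * C₂ (d ∸ c))
    ≡⟨ ∑<-cong (suc d) (λ c → cong (_* C₂ (d ∸ c)) (count-comps-suc P₁? L₁ c)) ⟨
  ∑< (suc d) (λ c → count P₁? (comps (suc L₁) c) * C₂ (d ∸ c)) ∎
  where
  open ≡-Reasoning
  C₁ : ℕ → ℕ → ℕ
  C₁ a c = count (P₁? ∘ (a ∷_)) (comps L₁ c)
  C₂ : ℕ → ℕ
  C₂ c = count P₂? (comps L₂ c)
  F : ℕ → ℕ → ℕ
  F a b = C₁ a b * C₂ (d ∸ a ∸ b)
  d∸a∸[c∸a] : ∀ c a → a ≤ c → d ∸ a ∸ (c ∸ a) ≡ d ∸ c
  d∸a∸[c∸a] c a a≤c = trans (∸-+-assoc d a (c ∸ a)) (cong (d ∸_) (m+[n∸m]≡n a≤c))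

sum≡0⇒zeros : ∀ xs → sum xs ≡ 0 → All (_≡ 0) xs
sum≡0⇒zeros []       _   = []
sum≡0⇒zeros (x ∷ xs) eq = m+n≡0⇒m≡0 x eq ∷ sum≡0⇒zeros xs (m+n≡0⇒n≡0 x eq)

sumℤ-++ : ∀ xs ys → sumℤ (xs ++ ys) ≡ sumℤ xs ℤ.+ sumℤ ys
sumℤ-++ []       ys = sym (ℤ.+-identityˡ _)
sumℤ-++ (x ∷ xs) ys = trans (cong (ℤ._+_ x) (sumℤ-++ xs ys)) (sym (ℤ.+-assoc x _ _))

++-injective : ∀ {A : Set} (xs ys : List A) {xs′ ys′} → length xs ≡ length ys →
  xs ++ xs′ ≡ ys ++ ys′ → xs ≡ ys × xs′ ≡ ys′
++-injective []       []       _         eq = refl , eq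
++-injective (x ∷ xs) (y ∷ ys) |xs|≡|ys| eq with ∷-injective eq
... | refl , eq′ with ++-injective xs ys (suc-injective |xs|≡|ys|) eq′
... | refl , eq″ = refl , eq″

same-elements-↭ : ∀ {A : Set} {xs ys : List A} → Unique xs → Unique ys →
  (∀ {x} → x ∈ xs → x ∈ ys) → (∀ {x} → x ∈ ys → x ∈ xs) → xs ↭ ys
same-elements-↭ xs! ys! xs⊆ys ys⊆xs = ∼bag⇒↭ (unique∧set⇒bag xs! ys! (mk⇔ xs⊆ys ys⊆xs))

positions-suc : ∀ n → positions (suc n) ≡ positions n ++ [ suc n ]
positions-suc n = trans (cong (map suc) (sym (upTo-∷ʳ n))) (map-++ suc (upTo n) [ n ])

positions-suc-front : ∀ n → positions (suc n) ≡ 1 ∷ map suc (positions n)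
positions-suc-front n = cong (λ l → 1 ∷ map suc l) (sym (map-upTo suc n))

length-positions : ∀ n → length (positions n) ≡ n
length-positions n = trans (length-map suc (upTo n)) (length-upTo n)

length-map-positions : ∀ {A : Set} n (f : ℕ → A) → length (map f (positions n)) ≡ n
length-map-positions n f = trans (length-map f (positions n)) (length-positions n)

positions-bounded : ∀ n → All (λ k → 1 ≤ k × k ≤ n) (positions n)
positions-bounded n = All.tabulate λ k∈ → bounded (∈-map⁻ suc k∈)
  where
  bounded : ∀ {k} → ∃ (λ t → t ∈ upTo n × k ≡ suc t) → 1 ≤ k × k ≤ n
  bounded (t , t∈ , refl) = s≤s z≤n , ∈-upTo⁻ t∈

positions-+ : ∀ a b → positions (a + b) ≡ positions a ++ map (a +_) (positions b)
positions-+ a zero    = trans (cong positions (+-identityʳ a)) (sym (++-identityʳ (positions a)))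
positions-+ a (suc b) = begin
  positions (a + suc b)
    ≡⟨ cong positions (+-suc a b) ⟩
  positions (suc (a + b))
    ≡⟨ positions-suc (a + b) ⟩
  positions (a + b) ++ [ suc (a + b) ]
    ≡⟨ cong₂ _++_ (positions-+ a b) (cong [_] (sym (+-suc a b))) ⟩
  (positions a ++ map (a +_) (positions b)) ++ [ a + suc b ]
    ≡⟨ ++-assoc (positions a) _ _ ⟩
  positions a ++ (map (a +_) (positions b) ++ [ a + suc b ])
    ≡⟨ cong (positions a ++_) (map-++ (a +_) (positions b) [ suc b ]) ⟨
  positions a ++ map (a +_) (positions b ++ [ suc b ])
    ≡⟨ cong (λ l → positions a ++ map (a +_) l) (positions-suc b) ⟨
  positions a ++ map (a +_) (positions (suc b)) ∎
  where open ≡-Reasoning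

reverse-positions : ∀ n → reverse (positions n) ≡ map (suc n ∸_) (positions n)
reverse-positions zero    = refl
reverse-positions (suc n) = begin
  reverse (positions (suc n))                        ≡⟨ cong reverse (positions-suc n) ⟩
  reverse (positions n ++ [ suc n ])                 ≡⟨ reverse-++ (positions n) [ suc n ] ⟩
  suc n ∷ reverse (positions n)                      ≡⟨ cong (suc n ∷_) (reverse-positions n) ⟩
  suc n ∷ map (suc n ∸_) (positions n)               ≡⟨ cong (suc n ∷_) (map-∘ (positions n)) ⟩
  suc n ∷ map (suc (suc n) ∸_) (map suc (positions n)) ≡⟨ cong (map (suc (suc n) ∸_)) (positions-suc-front n) ⟨
  map (suc (suc n) ∸_) (positions (suc n))           ∎
  where open ≡-Reasoning

IsPair : ℕ → ℕ × ℕ → Set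
IsPair n (i , j) = 1 ≤ i × i < j × j ≤ n

private
  row : ℕ → ℕ → List (ℕ × ℕ)
  row n i = map (λ t → (i , suc i + t)) (upTo (n ∸ i))

∈-pairs⁻ : ∀ n {p} → p ∈ pairs n → IsPair n p
∈-pairs⁻ n p∈ with find (∈-concatMap⁻ (row n) {xs = positions n} p∈)
... | i , i∈ , p∈row with ∈-map⁻ suc i∈ | ∈-map⁻ (λ t → (i , suc i + t)) p∈row
... | i′ , i′∈ , refl | t , t∈ , refl = s≤s z≤n , s≤s (m≤m+n (suc i′) t) , j≤n
  where
  open ≤-Reasoning
  j≤n : suc (suc i′) + t ≤ n
  j≤n = begin
    suc (suc i′) + t       ≡⟨ +-suc (suc i′) t ⟨
    suc i′ + suc t         ≤⟨ +-monoʳ-≤ (suc i′) (∈-upTo⁻ t∈) ⟩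
    suc i′ + (n ∸ suc i′)  ≡⟨ m+[n∸m]≡n (∈-upTo⁻ i′∈) ⟩
    n                      ∎

∈-pairs⁺ : ∀ n {p} → IsPair n p → p ∈ pairs n
∈-pairs⁺ n {suc i′ , suc j′} (s≤s z≤n , s≤s i<j′ , j≤n) =
  ∈-concatMap⁺ (row n) {xs = positions n}
    (lose (∈-map⁺ suc (∈-upTo⁺ {n} {i′} (<⇒≤ (≤-trans (s≤s i<j′) j≤n))))
          (subst (_∈ row n (suc i′)) (cong (suc i′ ,_) (m+[n∸m]≡n (s≤s i<j′)))
                 (∈-map⁺ (λ t → (suc i′ , suc (suc i′) + t)) (∈-upTo⁺ t<))))
  where
  t< : suc j′ ∸ suc (suc i′) < n ∸ suc i′
  t< = subst (_≤ n ∸ suc i′) (+-∸-assoc 1 i<j′) (∸-monoˡ-≤ (suc i′) j≤n)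

pairs-unique : ∀ n → Unique (pairs n)
pairs-unique n = Unique.concat⁺ (Allₚ.map⁺ rows-unique) (AllPairs.map⁺ rows-disjoint)
  where
  rows-unique : All (Unique ∘ row n) (positions n)
  rows-unique = All.tabulate λ {i} _ →
    Unique.map⁺ (λ e → +-cancelˡ-≡ (suc i) _ _ (cong proj₂ e)) (Unique.upTo⁺ (n ∸ i))
  row-fst : ∀ i {p} → p ∈ row n i → proj₁ p ≡ i
  row-fst i p∈ with ∈-map⁻ (λ t → (i , suc i + t)) p∈
  ... | _ , _ , refl = refl
  rows-disjoint : AllPairs (λ i i′ → Disjoint (row n i) (row n i′)) (positions n)
  rows-disjoint = AllPairs.map (λ i≢i′ {_} (p∈ , p∈′) → i≢i′ (trans (sym (row-fst _ p∈)) (row-fst _ p∈′)))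
                               (Unique.map⁺ suc-injective (Unique.upTo⁺ n))

psums-++ : ∀ acc xs ys → psums acc (xs ++ ys) ≡ psums acc xs ++ psums (acc + sum xs) ys
psums-++ acc []       ys = cong (λ a → psums a ys) (sym (+-identityʳ acc))
psums-++ acc (x ∷ xs) ys = cong ((acc + x) ∷_)
  (trans (psums-++ (acc + x) xs ys) (cong (λ a → psums (acc + x) xs ++ psums a ys) (+-assoc acc x (sum xs))))

psums-+ : ∀ a b ys → psums (a + b) ys ≡ map (a +_) (psums b ys)
psums-+ a b []       = refl
psums-+ a b (y ∷ ys) =
  cong₂ _∷_ (+-assoc a b y) (trans (cong (λ c → psums c ys) (+-assoc a b y)) (psums-+ a (b + y) ys))

sum∈psums : ∀ acc θ → 0 < sum θ → acc + sum θ ∈ psums acc θ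
sum∈psums acc (x ∷ xs) _ = last acc x xs
  where
  last : ∀ acc x xs → acc + sum (x ∷ xs) ∈ psums acc (x ∷ xs)
  last acc x []       = here (cong (acc +_) (+-identityʳ x))
  last acc x (y ∷ ys) = there (subst (_∈ psums (acc + x) (y ∷ ys)) (+-assoc acc x _) (last (acc + x) y ys))

∈-psums-≤ : ∀ acc θ {r} → r ∈ psums acc θ → r ≤ acc + sum θ
∈-psums-≤ acc (x ∷ xs) (here refl) = +-monoʳ-≤ acc (m≤m+n x (sum xs))
∈-psums-≤ acc (x ∷ xs) {r} (there r∈)  = subst (r ≤_) (+-assoc acc x (sum xs)) (∈-psums-≤ (acc + x) xs r∈)

Separated : List ℕ → ℕ × ℕ → Set
Separated θ (i , j) = ∃ λ r → r ∈ psums 0 θ × i ≤ r × r < j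

inPhi⁻ : ∀ θ {p} → T (inPhi θ p) → Separated θ p
inPhi⁻ θ t with find (any⁻ _ (psums 0 θ) t)
... | r , r∈ , t′ with Equivalence.to T-∧ t′
... | i≤r , r<j = r , r∈ , ≤ᵇ⇒≤ _ r i≤r , <ᵇ⇒< r _ r<j

inPhi⁺ : ∀ θ {p} → Separated θ p → T (inPhi θ p)
inPhi⁺ θ (r , r∈ , i≤r , r<j) = any⁺ _ (lose r∈ (Equivalence.from T-∧ (≤⇒≤ᵇ i≤r , <⇒<ᵇ r<j)))

∈-Phi⁻ : ∀ θ {p} → p ∈ Phi θ → IsPair (sum θ) p × Separated θ p
∈-Phi⁻ θ p∈ with ∈-filter⁻ (T? ∘ inPhi θ) {xs = pairs (sum θ)} p∈
... | p∈pairs , t = ∈-pairs⁻ (sum θ) p∈pairs , inPhi⁻ θ t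

∈-Phi⁺ : ∀ θ {p} → IsPair (sum θ) p → Separated θ p → p ∈ Phi θ
∈-Phi⁺ θ p s = ∈-filter⁺ (T? ∘ inPhi θ) (∈-pairs⁺ (sum θ) p) (inPhi⁺ θ s)

Phi-pairs : ∀ θ → All (IsPair (sum θ)) (Phi θ)
Phi-pairs θ = All.tabulate (proj₁ ∘ ∈-Phi⁻ θ)

Phi-unique : ∀ θ → Unique (Phi θ)
Phi-unique θ = Unique.filter⁺ (T? ∘ inPhi θ) (pairs-unique (sum θ))

pick : ℕ → ℕ → ℕ → ℤ
pick i a k = if i ≡ᵇ k then ℤ.+ a else 0ℤ

-- net (p ∷ ps) (a ∷ m) k reduces to δ p a k ℤ.+ net ps m k.
δ : ℕ × ℕ → ℕ → ℕ → ℤ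
δ (i , j) a k = pick i a k ℤ.- pick j a k

≡ᵇ-cong : ∀ {i k j l} → (i ≡ k ⇔ j ≡ l) → (i ≡ᵇ k) ≡ (j ≡ᵇ l)
≡ᵇ-cong {i} {k} {j} {l} i≡k⇔j≡l with i ≡ᵇ k in e₁ | j ≡ᵇ l in e₂
... | true  | true  = refl
... | false | false = refl
... | true  | false = ⊥-elim (subst T e₂ (≡⇒≡ᵇ j l (Equivalence.to i≡k⇔j≡l (≡ᵇ⇒≡ i k (subst T (sym e₁) _)))))
... | false | true  = ⊥-elim (subst T e₁ (≡⇒≡ᵇ i k (Equivalence.from i≡k⇔j≡l (≡ᵇ⇒≡ j l (subst T (sym e₂) _)))))

pick-cong : ∀ {i k j l} a → (i ≡ k ⇔ j ≡ l) → pick i a k ≡ pick j a l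
pick-cong a i≡k⇔j≡l = cong (λ b → if b then ℤ.+ a else 0ℤ) (≡ᵇ-cong i≡k⇔j≡l)

pick-0 : ∀ i k → pick i 0 k ≡ 0ℤ
pick-0 i k with i ≡ᵇ k
... | true  = refl
... | false = refl

pick-≢ : ∀ {i k} a → i ≢ k → pick i a k ≡ 0ℤ
pick-≢ {i} {k} a i≢k with i ≡ᵇ k in e
... | true  = ⊥-elim (i≢k (≡ᵇ⇒≡ i k (subst T (sym e) _)))
... | false = refl

pick-self : ∀ k a → pick k a k ≡ ℤ.+ a
pick-self k a with k ≡ᵇ k in e
... | true  = refl
... | false = ⊥-elim (subst T e (≡⇒≡ᵇ k k refl))

δ-0 : ∀ p k → δ p 0 k ≡ 0ℤ
δ-0 (i , j) k = cong₂ ℤ._-_ (pick-0 i k) (pick-0 j k)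

net-++ : ∀ A B u v k → length u ≡ length A → net (A ++ B) (u ++ v) k ≡ net A u k ℤ.+ net B v k
net-++ []      B []      v k _     = sym (ℤ.+-identityˡ _)
net-++ (p ∷ A) B (a ∷ u) v k |u|≡|A| =
  trans (cong (ℤ._+_ (δ p a k)) (net-++ A B u v k (suc-injective |u|≡|A|))) (sym (ℤ.+-assoc (δ p a k) _ _))

net-zeros-++ : ∀ A B w k → net (A ++ B) (replicate (length A) 0 ++ w) k ≡ net B w k
net-zeros-++ []      B w k = refl
net-zeros-++ (p ∷ A) B w k =
  trans (cong₂ ℤ._+_ (δ-0 p k) (net-zeros-++ A B w k)) (ℤ.+-identityˡ (net B w k))

Avoids : ℕ → ℕ × ℕ → Set
Avoids k (i , j) = i ≢ k × j ≢ k

net-avoiding : ∀ A u k → All (Avoids k) A → net A u k ≡ 0ℤ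
net-avoiding []            u       k _ = refl
net-avoiding (_ ∷ _)       []      k _ = refl
net-avoiding ((i , j) ∷ A) (a ∷ u) k ((i≢k , j≢k) ∷ avoids) =
  cong₂ ℤ._+_ (cong₂ ℤ._-_ (pick-≢ a i≢k) (pick-≢ a j≢k)) (net-avoiding A u k avoids)

shift : ℕ → ℕ × ℕ → ℕ × ℕ
shift c (i , j) = (c + i , c + j)

net-shift : ∀ c A u k → net (map (shift c) A) u (c + k) ≡ net A u k
net-shift c []            u       k = refl
net-shift c (_ ∷ _)       []      k = refl
net-shift c ((i , j) ∷ A) (a ∷ u) k = cong₂ ℤ._+_ (cong₂ ℤ._-_ (pick-shift i) (pick-shift j)) (net-shift c A u k)
  where
  pick-shift : ∀ x → pick (c + x) a (c + k) ≡ pick x a k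
  pick-shift x = pick-cong a (mk⇔ (+-cancelˡ-≡ c x k) (cong (c +_)))

Hits : ℕ → List (ℕ × ℕ) → List ℤ → List ℕ → Set
Hits n ps γ m = map (net ps m) (positions n) ≡ γ

hits? : ∀ n ps γ → Decidable (Hits n ps γ)
hits? n ps γ m = ≡-dec ℤ._≟_ (map (net ps m) (positions n)) γ

KΦ : ℕ → List (ℕ × ℕ) → List ℤ → ℕ → ℕ
KΦ n ps γ d = count (hits? n ps γ) (comps (length ps) d)

K≡KΦ : ∀ θ γ d → K θ γ d ≡ KΦ (sum θ) (Phi θ) γ d
K≡KΦ θ γ d = refl

move : (ℕ → ℤ) → ℕ × ℕ → ℕ → ℕ → ℤ
move off p a k = off k ℤ.+ δ p a k

-- KΦ-from n γ ps off d is the coefficient of q^d x^(γ - off) in ∏_{(i , j) ∈ ps} (1 - q x_i/x_j)⁻¹;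
-- the offset is what lets the product be expanded one factor at a time (KΦ-from-∷).
module _ (n : ℕ) (γ : List ℤ) where

  Reaches : List (ℕ × ℕ) → (ℕ → ℤ) → List ℕ → Set
  Reaches ps off m = map (λ k → off k ℤ.+ net ps m k) (positions n) ≡ γ

  reaches? : ∀ ps off → Decidable (Reaches ps off)
  reaches? ps off m = ≡-dec ℤ._≟_ _ γ

  KΦ-from : List (ℕ × ℕ) → (ℕ → ℤ) → ℕ → ℕ
  KΦ-from ps off d = count (reaches? ps off) (comps (length ps) d)

  reaches-≐ : ∀ ps qs off off′ (f g : List ℕ → List ℕ) →
    (∀ m k → off k ℤ.+ net ps (f m) k ≡ off′ k ℤ.+ net qs (g m) k) →
    (Reaches ps off ∘ f) ≐ (Reaches qs off′ ∘ g)
  reaches-≐ ps qs off off′ f g f≈g = (λ {m} → trans (map-cong (sym ∘ f≈g m) (positions n)))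
                    , (λ {m} → trans (map-cong (f≈g m) (positions n)))

  KΦ-from-cong : ∀ ps {off off′} → off ≗ off′ → ∀ d → KΦ-from ps off d ≡ KΦ-from ps off′ d
  KΦ-from-cong ps {off} {off′} off≗off′ d = count-cong (reaches? ps off) (reaches? ps off′)
    (reaches-≐ ps ps off off′ id id (λ m k → cong (ℤ._+ net ps m k) (off≗off′ k))) (comps (length ps) d)

  KΦ-from-∷ : ∀ p ps off d →
    KΦ-from (p ∷ ps) off d ≡ ∑< (suc d) (λ a → KΦ-from ps (move off p a) (d ∸ a))
  KΦ-from-∷ p ps off d = trans (count-comps-suc (reaches? (p ∷ ps) off) (length ps) d)
    (∑<-cong (suc d) λ a → count-cong (reaches? (p ∷ ps) off ∘ (a ∷_)) (reaches? ps (move off p a))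
      (reaches-≐ (p ∷ ps) ps off (move off p a) (a ∷_) id (λ m k → sym (ℤ.+-assoc (off k) (δ p a k) (net ps m k))))
      (comps (length ps) (d ∸ a)))

  KΦ-from-swap : ∀ p q ps off d → KΦ-from (p ∷ q ∷ ps) off d ≡ KΦ-from (q ∷ p ∷ ps) off d
  KΦ-from-swap p q ps off d = begin
    KΦ-from (p ∷ q ∷ ps) off d
      ≡⟨ KΦ-from-∷ p (q ∷ ps) off d ⟩
    ∑< (suc d) (λ a → KΦ-from (q ∷ ps) (move off p a) (d ∸ a))
      ≡⟨ ∑<-cong (suc d) (λ a → KΦ-from-∷ q ps (move off p a) (d ∸ a)) ⟩
    ∑△ d (λ a b → KΦ-from ps (move (move off p a) q b) (d ∸ a ∸ b))
      ≡⟨ ∑△-swap d (λ a b → KΦ-from ps (move (move off p a) q b) (d ∸ a ∸ b)) ⟩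
    ∑△ d (λ a b → KΦ-from ps (move (move off p b) q a) (d ∸ b ∸ a))
      ≡⟨ ∑<-cong (suc d) (λ a → ∑<-cong (suc (d ∸ a)) (λ b →
           trans (KΦ-from-cong ps (λ k → xy∙z≈xz∙y ℤ.+-commutativeSemigroup (off k) (δ p b k) (δ q a k)) (d ∸ b ∸ a))
                 (cong (KΦ-from ps (move (move off q a) p b)) (∸-comm d b a)))) ⟩
    ∑△ d (λ a b → KΦ-from ps (move (move off q a) p b) (d ∸ a ∸ b))
      ≡⟨ ∑<-cong (suc d) (λ a → KΦ-from-∷ p ps (move off q a) (d ∸ a)) ⟨
    ∑< (suc d) (λ a → KΦ-from (p ∷ ps) (move off q a) (d ∸ a))
      ≡⟨ KΦ-from-∷ q (p ∷ ps) off d ⟨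
    KΦ-from (q ∷ p ∷ ps) off d ∎
    where
    open ≡-Reasoning
    ∸-comm : ∀ d b a → d ∸ b ∸ a ≡ d ∸ a ∸ b
    ∸-comm d b a = trans (∸-+-assoc d b a) (trans (cong (d ∸_) (+-comm b a)) (sym (∸-+-assoc d a b)))

  KΦ-from-prep : ∀ p ps qs → (∀ off d → KΦ-from ps off d ≡ KΦ-from qs off d) →
    ∀ off d → KΦ-from (p ∷ ps) off d ≡ KΦ-from (p ∷ qs) off d
  KΦ-from-prep p ps qs ps≈qs off d = trans (KΦ-from-∷ p ps off d)
    (trans (∑<-cong (suc d) (λ a → ps≈qs (move off p a) (d ∸ a))) (sym (KΦ-from-∷ p qs off d)))

  KΦ-from-↭ : ∀ {ps qs} → ps ↭ qs → ∀ off d → KΦ-from ps off d ≡ KΦ-from qs off d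
  KΦ-from-↭ ↭.refl           off d = refl
  KΦ-from-↭ {p ∷ ps} {_ ∷ qs} (↭.prep p ps↭qs) off d = KΦ-from-prep p ps qs (KΦ-from-↭ ps↭qs) off d
  KΦ-from-↭ {p ∷ q ∷ ps} {_ ∷ _ ∷ qs} (↭.swap p q ps↭qs) off d =
    trans (KΦ-from-swap p q ps off d)
          (KΦ-from-prep q (p ∷ ps) (p ∷ qs) (KΦ-from-prep p ps qs (KΦ-from-↭ ps↭qs)) off d)
  KΦ-from-↭ (↭.trans ps↭qs qs↭rs) off d = trans (KΦ-from-↭ ps↭qs off d) (KΦ-from-↭ qs↭rs off d)

  KΦ-from-⊆ : ∀ {ps qs} → ps ⊆ qs → ∀ off d → KΦ-from ps off d ≤ KΦ-from qs off d
  KΦ-from-⊆ [] off d = ≤-refl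
  KΦ-from-⊆ {ps} {q ∷ qs} (q ∷ʳ ps⊆qs) off d = begin
    KΦ-from ps off d
      ≤⟨ KΦ-from-⊆ ps⊆qs off d ⟩
    KΦ-from qs off d
      ≡⟨ KΦ-from-cong qs (λ k → trans (cong (λ z → off k ℤ.+ z) (δ-0 q k)) (ℤ.+-identityʳ (off k))) d ⟨
    KΦ-from qs (move off q 0) d
      ≤⟨ m≤m+n _ _ ⟩
    ∑< (suc d) (λ a → KΦ-from qs (move off q a) (d ∸ a))
      ≡⟨ KΦ-from-∷ q qs off d ⟨
    KΦ-from (q ∷ qs) off d ∎
    where open ≤-Reasoning
  KΦ-from-⊆ {p ∷ ps} {_ ∷ qs} (refl ∷ ps⊆qs) off d = begin
    KΦ-from (p ∷ ps) off d
      ≡⟨ KΦ-from-∷ p ps off d ⟩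
    ∑< (suc d) (λ a → KΦ-from ps (move off p a) (d ∸ a))
      ≤⟨ ∑<-mono-≤ (suc d) (λ a → KΦ-from-⊆ ps⊆qs (move off p a) (d ∸ a)) ⟩
    ∑< (suc d) (λ a → KΦ-from qs (move off p a) (d ∸ a))
      ≡⟨ KΦ-from-∷ p qs off d ⟨
    KΦ-from (p ∷ qs) off d ∎
    where open ≤-Reasoning

KΦ≡KΦ-from-0 : ∀ n γ ps d → KΦ n ps γ d ≡ KΦ-from n γ ps (λ _ → 0ℤ) d
KΦ≡KΦ-from-0 n γ ps d = count-cong (hits? n ps γ) (reaches? n γ ps (λ _ → 0ℤ))
  ((λ {m} → trans (map-cong (λ k → ℤ.+-identityˡ (net ps m k)) (positions n)))
  , (λ {m} → trans (sym (map-cong (λ k → ℤ.+-identityˡ (net ps m k)) (positions n)))))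
  (comps (length ps) d)

KΦ-↭ : ∀ n γ {ps qs} → ps ↭ qs → ∀ d → KΦ n ps γ d ≡ KΦ n qs γ d
KΦ-↭ n γ {ps} {qs} ps↭qs d = begin
  KΦ n ps γ d                    ≡⟨ KΦ≡KΦ-from-0 n γ ps d ⟩
  KΦ-from n γ ps (λ _ → 0ℤ) d    ≡⟨ KΦ-from-↭ n γ ps↭qs (λ _ → 0ℤ) d ⟩
  KΦ-from n γ qs (λ _ → 0ℤ) d    ≡⟨ KΦ≡KΦ-from-0 n γ qs d ⟨
  KΦ n qs γ d                    ∎
  where open ≡-Reasoning

KΦ-⊆ : ∀ n γ {ps qs} → ps ⊆ qs → ∀ d → KΦ n ps γ d ≤ KΦ n qs γ d
KΦ-⊆ n γ {ps} {qs} ps⊆qs d = begin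
  KΦ n ps γ d                    ≡⟨ KΦ≡KΦ-from-0 n γ ps d ⟩
  KΦ-from n γ ps (λ _ → 0ℤ) d    ≤⟨ KΦ-from-⊆ n γ ps⊆qs (λ _ → 0ℤ) d ⟩
  KΦ-from n γ qs (λ _ → 0ℤ) d    ≡⟨ KΦ≡KΦ-from-0 n γ qs d ⟨
  KΦ n qs γ d                    ∎
  where open ≤-Reasoning

-- Part (iii): subdivision

∈-psums-concat : ∀ acc {μs η} → Pointwise (λ μ a → sum μ ≡ a) μs η → IsComposition η →
  ∀ {r} → r ∈ psums acc η → r ∈ psums acc (concat μs)
∈-psums-concat acc {μ ∷ μs} (refl ∷ _) (0<a ∷ _) (here refl) =
  subst (acc + sum μ ∈_) (sym (psums-++ acc μ (concat μs))) (∈-++⁺ˡ (sum∈psums acc μ 0<a))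
∈-psums-concat acc {μ ∷ μs} (refl ∷ sums) (_ ∷ η⁺) {r} (there r∈) =
  subst (r ∈_) (sym (psums-++ acc μ (concat μs))) (∈-++⁺ʳ (psums acc μ) (∈-psums-concat (acc + sum μ) sums η⁺ r∈))

Phi-⊆ : ∀ θ θ′ → sum θ ≡ sum θ′ → (∀ {r} → r ∈ psums 0 θ → r ∈ psums 0 θ′) → Phi θ ⊆ Phi θ′
Phi-⊆ θ θ′ θ≡θ′ refines = subst (λ n → filter (T? ∘ inPhi θ) (pairs n) ⊆ Phi θ′) (sym θ≡θ′)
  (filter⁺ (T? ∘ inPhi θ) (T? ∘ inPhi θ′) (λ { {p} refl → inPhi⁺ θ′ {p} ∘ coarser ∘ inPhi⁻ θ {p} })
           (⊆-refl {x = pairs (sum θ′)}))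
  where
  coarser : ∀ {p} → Separated θ p → Separated θ′ p
  coarser (r , r∈ , i≤r , r<j) = r , refines r∈ , i≤r , r<j

K-mono-refinement : ∀ θ θ′ γ → sum θ ≡ sum θ′ → (∀ {r} → r ∈ psums 0 θ → r ∈ psums 0 θ′) →
  ∀ d → K θ γ d ≤ K θ′ γ d
K-mono-refinement θ θ′ γ θ≡θ′ refines d = begin
  K θ γ d                        ≡⟨ K≡KΦ θ γ d ⟩
  KΦ (sum θ) (Phi θ) γ d         ≡⟨ cong (λ n → KΦ n (Phi θ) γ d) θ≡θ′ ⟩
  KΦ (sum θ′) (Phi θ) γ d        ≤⟨ KΦ-⊆ (sum θ′) γ (Phi-⊆ θ θ′ θ≡θ′ refines) d ⟩
  KΦ (sum θ′) (Phi θ′) γ d       ≡⟨ K≡KΦ θ′ γ d ⟨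
  K θ′ γ d                       ∎
  where open ≤-Reasoning

K-mono-subdivision : ∀ η₁ η₂ γ → IsComposition η₁ → sum η₁ ≡ sum η₂ → IsSubdivision η₂ η₁ →
  ∀ d → K η₁ γ d ≤ K η₂ γ d
K-mono-subdivision η₁ _ γ η₁⁺ η₁≡η₂ (μs , parts , refl) =
  K-mono-refinement η₁ (concat μs) γ η₁≡η₂ (∈-psums-concat 0 (Pointwise.map proj₂ parts) η₁⁺)

-- Part (ii): reversal

sum-reverse : ∀ θ → sum (reverse θ) ≡ sum θ
sum-reverse θ = sum-↭ (↭-reverse θ)

-- Unlike psums, the cut points r₀ = 0, r₁, …, r_p are symmetric under r ↦ |θ| ∸ r.
cuts : List ℕ → List ℕ
cuts θ = 0 ∷ psums 0 θ

cuts-reverse : ∀ θ → cuts (reverse θ) ≡ reverse (map (sum θ ∸_) (cuts θ))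
cuts-reverse []       = refl
cuts-reverse (x ∷ xs) = begin
  cuts (reverse (x ∷ xs))                          ≡⟨ cong cuts (unfold-reverse x xs) ⟩
  0 ∷ psums 0 (reverse xs ++ [ x ])                ≡⟨ cong (0 ∷_) (psums-++ 0 (reverse xs) [ x ]) ⟩
  cuts (reverse xs) ++ [ sum (reverse xs) + x ]
    ≡⟨ cong₂ (λ l z → l ++ [ z ]) (cuts-reverse xs) (trans (cong (_+ x) (sum-reverse xs)) (+-comm s x)) ⟩
  reverse (map (s ∸_) (cuts xs)) ++ [ x + s ]      ≡⟨ unfold-reverse (x + s) (map (s ∸_) (cuts xs)) ⟨
  reverse ((x + s) ∷ map (s ∸_) (cuts xs))         ≡⟨ cong (λ l → reverse ((x + s) ∷ l)) shifted ⟩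
  reverse (map ((x + s) ∸_) (cuts (x ∷ xs)))       ∎
  where
  open ≡-Reasoning
  s : ℕ
  s = sum xs
  shifted : map (s ∸_) (cuts xs) ≡ map ((x + s) ∸_) (x ∷ psums x xs)
  shifted = cong₂ _∷_ (sym (m+n∸m≡n x s)) (begin
    map (s ∸_) (psums 0 xs)                       ≡⟨ map-cong (λ r → sym ([m+n]∸[m+o]≡n∸o x s r)) (psums 0 xs) ⟩
    map (λ r → (x + s) ∸ (x + r)) (psums 0 xs)    ≡⟨ map-∘ (psums 0 xs) ⟩
    map ((x + s) ∸_) (map (x +_) (psums 0 xs))    ≡⟨ cong (map ((x + s) ∸_)) (psums-+ x 0 xs) ⟨
    map ((x + s) ∸_) (psums (x + 0) xs)           ≡⟨ cong (λ c → map ((x + s) ∸_) (psums c xs)) (+-identityʳ x) ⟩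
    map ((x + s) ∸_) (psums x xs)                 ∎)

reflect : ℕ → ℕ × ℕ → ℕ × ℕ
reflect n (i , j) = (suc n ∸ j , suc n ∸ i)

reflect-IsPair : ∀ n {p} → IsPair n p → IsPair n (reflect n p)
reflect-IsPair n (1≤i , i<j , j≤n) = m<n⇒0<n∸m (s≤s j≤n) , ∸-monoʳ-< i<j (m≤n⇒m≤1+n j≤n) , ∸-monoʳ-≤ (suc n) 1≤i

reflect-involutive : ∀ n {p} → IsPair n p → reflect n (reflect n p) ≡ p
reflect-involutive n (_ , i<j , j≤n) =
  cong₂ _,_ (m∸[m∸n]≡n (≤-trans (<⇒≤ i<j) (m≤n⇒m≤1+n j≤n))) (m∸[m∸n]≡n (m≤n⇒m≤1+n j≤n))

Separated-reverse : ∀ θ {p} → IsPair (sum θ) p → Separated θ p → Separated (reverse θ) (reflect (sum θ) p)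
Separated-reverse θ {i , j} (_ , _ , j≤n) (r , r∈ , i≤r , r<j) =
  n ∸ r , n∸r∈ , ∸-monoʳ-≤ (suc n) r<j , subst (_≤ suc n ∸ i) (+-∸-assoc 1 (∈-psums-≤ 0 θ r∈)) (∸-monoʳ-≤ (suc n) i≤r)
  where
  n : ℕ
  n = sum θ
  n∸r∈ : n ∸ r ∈ psums 0 (reverse θ)
  n∸r∈ with subst (n ∸ r ∈_) (sym (cuts-reverse θ)) (reverse⁺ (∈-map⁺ (n ∸_) (there {x = 0} r∈)))
  ... | here n∸r≡0 = ⊥-elim (<⇒≢ (m<n⇒0<n∸m (<-≤-trans r<j j≤n)) (sym n∸r≡0))
  ... | there n∸r∈ = n∸r∈

Separated-reverse⁻ : ∀ θ {p} → IsPair (sum θ) p → Separated (reverse θ) p → Separated θ (reflect (sum θ) p)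
Separated-reverse⁻ θ {p} pair sep =
  subst₂ (λ θ′ n → Separated θ′ (reflect n p)) (reverse-involutive θ) (sum-reverse θ)
  (Separated-reverse (reverse θ) (subst (λ n → IsPair n p) (sym (sum-reverse θ)) pair) sep)

Phi-reverse-↭ : ∀ η → Phi (reverse η) ↭ map (reflect (sum η)) (Phi η)
Phi-reverse-↭ η = same-elements-↭ (Phi-unique (reverse η)) reflected-unique into onto
  where
  n : ℕ
  n = sum η
  sum-rev : ∀ {p} → IsPair (sum (reverse η)) p → IsPair n p
  sum-rev {p} = subst (λ m → IsPair m p) (sum-reverse η)
  reflected-unique : Unique (map (reflect n) (Phi η))
  reflected-unique = Unique.map⁻ (subst Unique (sym reflect-twice) (Phi-unique η))
    where
    reflect-twice : map (reflect n) (map (reflect n) (Phi η)) ≡ Phi η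
    reflect-twice = trans (sym (map-∘ (Phi η))) (map-id-local (All.map (reflect-involutive n) (Phi-pairs η)))
  into : ∀ {p} → p ∈ Phi (reverse η) → p ∈ map (reflect (sum η)) (Phi η)
  into {p} p∈ with ∈-Phi⁻ (reverse η) p∈
  ... | pair , sep = subst (_∈ map (reflect n) (Phi η)) (reflect-involutive n (sum-rev pair))
      (∈-map⁺ (reflect n) (∈-Phi⁺ η (reflect-IsPair n (sum-rev pair)) (Separated-reverse⁻ η (sum-rev pair) sep)))
  onto : ∀ {p} → p ∈ map (reflect (sum η)) (Phi η) → p ∈ Phi (reverse η)
  onto p∈ with ∈-map⁻ (reflect n) p∈
  ... | q , q∈ , refl with ∈-Phi⁻ η q∈
  ... | pair , sep =
    ∈-Phi⁺ (reverse η) (subst (λ m → IsPair m (reflect n q)) (sym (sum-reverse η)) (reflect-IsPair n pair))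
                       (Separated-reverse η pair sep)

pick-reflect : ∀ {N j k} a → j ≤ N → k ≤ N → pick (N ∸ j) a k ≡ pick j a (N ∸ k)
pick-reflect {N} {j} {k} a j≤N k≤N = pick-cong {N ∸ j} {k} {j} {N ∸ k} a (mk⇔
  (λ { refl → sym (m∸[m∸n]≡n j≤N) })
  (λ { refl → m∸[m∸n]≡n k≤N }))

net-reflect : ∀ n ps m {k} → All (IsPair n) ps → 1 ≤ k → k ≤ n →
  net (map (reflect n) ps) m k ≡ - net ps m (suc n ∸ k)
net-reflect n []             m        _ _ _ = refl
net-reflect n ((i , j) ∷ ps) []       _ _ _ = refl
net-reflect n ((i , j) ∷ ps) (a ∷ m) {k} ((_ , i<j , j≤n) ∷ pairs) 1≤k k≤n = begin
  (pick (suc n ∸ j) a k ℤ.- pick (suc n ∸ i) a k) ℤ.+ net (map (reflect n) ps) m k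
    ≡⟨ cong₂ ℤ._+_ (cong₂ ℤ._-_ (pick-reflect a j≤1+n k≤1+n) (pick-reflect a (≤-trans (<⇒≤ i<j) j≤1+n) k≤1+n))
                   (net-reflect n ps m pairs 1≤k k≤n) ⟩
  (pick j a k′ ℤ.- pick i a k′) ℤ.+ - net ps m k′
    ≡⟨ negate-swap (pick i a k′) (pick j a k′) (net ps m k′) ⟩
  - ((pick i a k′ ℤ.- pick j a k′) ℤ.+ net ps m k′) ∎
  where
  open ≡-Reasoning
  k′ : ℕ
  k′ = suc n ∸ k
  j≤1+n : j ≤ suc n
  j≤1+n = m≤n⇒m≤1+n j≤n
  k≤1+n : k ≤ suc n
  k≤1+n = m≤n⇒m≤1+n k≤n
  negate-swap : ∀ x y z → (y ℤ.- x) ℤ.+ - z ≡ - ((x ℤ.- y) ℤ.+ z)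
  negate-swap = solve-∀

negate-reverse : List ℤ → List ℤ
negate-reverse = map -_ ∘ reverse

negate-reverse-involutive : ∀ xs → negate-reverse (negate-reverse xs) ≡ xs
negate-reverse-involutive xs = begin
  map -_ (reverse (map -_ (reverse xs))) ≡⟨ cong (map -_) (reverse-map -_ (reverse xs)) ⟨
  map -_ (map -_ (reverse (reverse xs))) ≡⟨ map-∘ (reverse (reverse xs)) ⟨
  map (-_ ∘ -_) (reverse (reverse xs))   ≡⟨ map-cong ℤ.neg-involutive (reverse (reverse xs)) ⟩
  map id (reverse (reverse xs))          ≡⟨ map-id (reverse (reverse xs)) ⟩
  reverse (reverse xs)                   ≡⟨ reverse-involutive xs ⟩
  xs                                     ∎
  where open ≡-Reasoning

weight-reflect : ∀ n ps m → All (IsPair n) ps →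
  map (net (map (reflect n) ps) m) (positions n) ≡ negate-reverse (map (net ps m) (positions n))
weight-reflect n ps m pairs = begin
  map (net (map (reflect n) ps) m) (positions n)
    ≡⟨ map-cong-local (All.map (λ (1≤k , k≤n) → net-reflect n ps m pairs 1≤k k≤n) (positions-bounded n)) ⟩
  map (λ k → - net ps m (suc n ∸ k)) (positions n)
    ≡⟨ map-∘ (positions n) ⟩
  map -_ (map (λ k → net ps m (suc n ∸ k)) (positions n))
    ≡⟨ cong (map -_) (map-∘ (positions n)) ⟩
  map -_ (map (net ps m) (map (suc n ∸_) (positions n)))
    ≡⟨ cong (λ l → map -_ (map (net ps m) l)) (reverse-positions n) ⟨
  map -_ (map (net ps m) (reverse (positions n)))
    ≡⟨ cong (map -_) (reverse-map (net ps m) (positions n)) ⟩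
  map -_ (reverse (map (net ps m) (positions n))) ∎
  where open ≡-Reasoning

KΦ-reflect : ∀ n ps γ d → All (IsPair n) ps → KΦ n (map (reflect n) ps) (negate-reverse γ) d ≡ KΦ n ps γ d
KΦ-reflect n ps γ d pairs =
  trans (cong (λ L → count (hits? n (map (reflect n) ps) (negate-reverse γ)) (comps L d)) (length-map (reflect n) ps))
        (count-cong (hits? n (map (reflect n) ps) (negate-reverse γ)) (hits? n ps γ)
                    ( (λ {m} → reflected⇒original m)
                    , (λ {m} w≡γ → trans (weight-reflect n ps m pairs) (cong negate-reverse w≡γ)) )
                    (comps (length ps) d))
  where
  reflected⇒original : ∀ m → Hits n (map (reflect n) ps) (negate-reverse γ) m → Hits n ps γ m
  reflected⇒original m w′≡γ′ = begin
    w                                     ≡⟨ negate-reverse-involutive w ⟨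
    negate-reverse (negate-reverse w)     ≡⟨ cong negate-reverse (trans (sym (weight-reflect n ps m pairs)) w′≡γ′) ⟩
    negate-reverse (negate-reverse γ)     ≡⟨ negate-reverse-involutive γ ⟩
    γ                                     ∎
    where
    open ≡-Reasoning
    w : List ℤ
    w = map (net ps m) (positions n)

K-reverse : ∀ η γ d → K η γ d ≡ K (reverse η) (negate-reverse γ) d
K-reverse η γ d = begin
  K η γ d                                  ≡⟨ K≡KΦ η γ d ⟩
  KΦ n (Phi η) γ d                         ≡⟨ KΦ-reflect n (Phi η) γ d (Phi-pairs η) ⟨
  KΦ n (map (reflect n) (Phi η)) γ′ d      ≡⟨ KΦ-↭ n γ′ (Phi-reverse-↭ η) d ⟨
  KΦ n (Phi (reverse η)) γ′ d              ≡⟨ cong (λ m → KΦ m (Phi (reverse η)) γ′ d) (sum-reverse η) ⟨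
  KΦ (sum (reverse η)) (Phi (reverse η)) γ′ d ≡⟨ K≡KΦ (reverse η) γ′ d ⟨
  K (reverse η) γ′ d                       ∎
  where
  open ≡-Reasoning
  n : ℕ
  n = sum η
  γ′ : List ℤ
  γ′ = negate-reverse γ

-- Part (i): concatenation

∑pos : ℕ → (ℕ → ℤ) → ℤ
∑pos n f = sumℤ (map f (positions n))

∑pos-suc : ∀ n f → ∑pos (suc n) f ≡ ∑pos n f ℤ.+ f (suc n)
∑pos-suc n f = begin
  sumℤ (map f (positions (suc n)))                   ≡⟨ cong (sumℤ ∘ map f) (positions-suc n) ⟩
  sumℤ (map f (positions n ++ [ suc n ]))            ≡⟨ cong sumℤ (map-++ f (positions n) [ suc n ]) ⟩
  sumℤ (map f (positions n) ++ [ f (suc n) ])        ≡⟨ sumℤ-++ (map f (positions n)) [ f (suc n) ] ⟩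
  ∑pos n f ℤ.+ (f (suc n) ℤ.+ 0ℤ)                    ≡⟨ cong (ℤ._+_ (∑pos n f)) (ℤ.+-identityʳ (f (suc n))) ⟩
  ∑pos n f ℤ.+ f (suc n)                             ∎
  where open ≡-Reasoning

∑pos-distrib-+ : ∀ n f g → ∑pos n (λ k → f k ℤ.+ g k) ≡ ∑pos n f ℤ.+ ∑pos n g
∑pos-distrib-+ n f g = go (positions n)
  where
  go : ∀ ks → sumℤ (map (λ k → f k ℤ.+ g k) ks) ≡ sumℤ (map f ks) ℤ.+ sumℤ (map g ks)
  go []       = refl
  go (k ∷ ks) = trans (cong (ℤ._+_ (f k ℤ.+ g k)) (go ks)) (interchange ℤ.+-commutativeSemigroup (f k) (g k) _ _)

∑pos-0 : ∀ n → ∑pos n (λ _ → 0ℤ) ≡ 0ℤ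
∑pos-0 zero    = refl
∑pos-0 (suc n) = trans (∑pos-suc n (λ _ → 0ℤ)) (trans (ℤ.+-identityʳ _) (∑pos-0 n))

∑pos-pick-outside : ∀ n i a → n < i → ∑pos n (pick i a) ≡ 0ℤ
∑pos-pick-outside zero    i a _   = refl
∑pos-pick-outside (suc n) i a n<i = begin
  ∑pos (suc n) (pick i a)
    ≡⟨ ∑pos-suc n (pick i a) ⟩
  ∑pos n (pick i a) ℤ.+ pick i a (suc n)
    ≡⟨ cong₂ ℤ._+_ (∑pos-pick-outside n i a (<-trans (n<1+n n) n<i)) (pick-≢ a (>⇒≢ n<i)) ⟩
  0ℤ ∎
  where open ≡-Reasoning

∑pos-pick-inside : ∀ n i a → 1 ≤ i → i ≤ n → ∑pos n (pick i a) ≡ ℤ.+ a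
∑pos-pick-inside zero    i a 1≤i i≤0   = ⊥-elim (<-irrefl refl (≤-trans 1≤i i≤0))
∑pos-pick-inside (suc n) i a 1≤i i≤1+n = begin
  ∑pos (suc n) (pick i a)                ≡⟨ ∑pos-suc n (pick i a) ⟩
  ∑pos n (pick i a) ℤ.+ pick i a (suc n) ≡⟨ last-or-earlier (m≤n⇒m<n∨m≡n i≤1+n) ⟩
  ℤ.+ a                                  ∎
  where
  open ≡-Reasoning
  last-or-earlier : i < suc n ⊎ i ≡ suc n → ∑pos n (pick i a) ℤ.+ pick i a (suc n) ≡ ℤ.+ a
  last-or-earlier (inj₁ i<1+n) =
    trans (cong₂ ℤ._+_ (∑pos-pick-inside n i a 1≤i (≤-pred i<1+n)) (pick-≢ a (<⇒≢ i<1+n))) (ℤ.+-identityʳ (ℤ.+ a))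
  last-or-earlier (inj₂ refl)  =
    trans (cong₂ ℤ._+_ (∑pos-pick-outside n (suc n) a (n<1+n n)) (pick-self (suc n) a)) (ℤ.+-identityˡ (ℤ.+ a))

∑pos-distrib-sub : ∀ n f g → ∑pos n (λ k → f k ℤ.- g k) ≡ ∑pos n f ℤ.- ∑pos n g
∑pos-distrib-sub n f g = go (positions n)
  where
  go : ∀ ks → sumℤ (map (λ k → f k ℤ.- g k) ks) ≡ sumℤ (map f ks) ℤ.- sumℤ (map g ks)
  go []       = refl
  go (k ∷ ks) = trans (cong (ℤ._+_ (f k ℤ.- g k)) (go ks)) (sub-interchange (f k) (g k) _ _)
    where
    sub-interchange : ∀ a b c d → (a ℤ.- b) ℤ.+ (c ℤ.- d) ≡ (a ℤ.+ c) ℤ.- (b ℤ.+ d)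
    sub-interchange = solve-∀

Above : ℕ → ℕ × ℕ → Set
Above n (i , j) = n < i × i < j

Balanced : ℕ → ℕ × ℕ → Set
Balanced n p = IsPair n p ⊎ Above n p

Crossing : ℕ → ℕ × ℕ → Set
Crossing n (i , j) = 1 ≤ i × i ≤ n × n < j

crossing? : ∀ n → Decidable (Crossing n)
crossing? n (i , j) = (1 ≤? i) ×-dec (i ≤? n) ×-dec (n <? j)

∑pos-δ-balanced : ∀ n {p} a → Balanced n p → ∑pos n (δ p a) ≡ 0ℤ
∑pos-δ-balanced n {i , j} a (inj₁ (1≤i , i<j , j≤n)) =
  trans (∑pos-distrib-sub n (pick i a) (pick j a))
        (trans (cong₂ ℤ._-_ (∑pos-pick-inside n i a 1≤i (≤-trans (<⇒≤ i<j) j≤n))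
                            (∑pos-pick-inside n j a (≤-trans 1≤i (<⇒≤ i<j)) j≤n))
               (ℤ.+-inverseʳ (ℤ.+ a)))
∑pos-δ-balanced n {i , j} a (inj₂ (n<i , i<j)) =
  trans (∑pos-distrib-sub n (pick i a) (pick j a))
        (cong₂ ℤ._-_ (∑pos-pick-outside n i a n<i) (∑pos-pick-outside n j a (<-trans n<i i<j)))

∑pos-δ-crossing : ∀ n {p} a → Crossing n p → ∑pos n (δ p a) ≡ ℤ.+ a
∑pos-δ-crossing n {i , j} a (1≤i , i≤n , n<j) =
  trans (∑pos-distrib-sub n (pick i a) (pick j a))
        (trans (cong₂ ℤ._-_ (∑pos-pick-inside n i a 1≤i i≤n) (∑pos-pick-outside n j a n<j)) (ℤ.+-identityʳ (ℤ.+ a)))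

∑pos-net-balanced : ∀ n B u → All (Balanced n) B → ∑pos n (net B u) ≡ 0ℤ
∑pos-net-balanced n []      u       _ = ∑pos-0 n
∑pos-net-balanced n (_ ∷ _) []      _ = ∑pos-0 n
∑pos-net-balanced n (p ∷ B) (a ∷ u) (p-bal ∷ B-bal) =
  trans (∑pos-distrib-+ n (δ p a) (net B u)) (cong₂ ℤ._+_ (∑pos-δ-balanced n a p-bal) (∑pos-net-balanced n B u B-bal))

∑pos-net-crossing : ∀ n A B m → All (Crossing n) A → All (Balanced n) B →
  ∑pos n (net (A ++ B) m) ≡ ℤ.+ sum (take (length A) m)
∑pos-net-crossing n []      B m       _ B-bal = ∑pos-net-balanced n B m B-bal
∑pos-net-crossing n (_ ∷ _) B []      _ _     = ∑pos-0 n
∑pos-net-crossing n (p ∷ A) B (a ∷ m) (p-cross ∷ A-cross) B-bal =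
  trans (∑pos-distrib-+ n (δ p a) (net (A ++ B) m))
        (trans (cong₂ ℤ._+_ (∑pos-δ-crossing n a p-cross) (∑pos-net-crossing n A B m A-cross B-bal))
               (sym (ℤ.pos-+ a _)))

module Concatenation (η₁ η₂ : List ℕ) where

  n₁ n₂ N : ℕ
  n₁ = sum η₁
  n₂ = sum η₂
  N  = n₁ + n₂

  crossing shifted blocks : List (ℕ × ℕ)
  crossing = filter (crossing? n₁) (pairs N)
  shifted  = map (shift n₁) (Phi η₂)
  blocks   = crossing ++ (Phi η₁ ++ shifted)

  IsPair-N : ∀ {p} → IsPair N p → IsPair (sum (η₁ ++ η₂)) p
  IsPair-N {p} = subst (λ n → IsPair n p) (sym (sum-++ η₁ η₂))

  psums-concat : psums 0 (η₁ ++ η₂) ≡ psums 0 η₁ ++ map (n₁ +_) (psums 0 η₂)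
  psums-concat = trans (psums-++ 0 η₁ η₂) (cong (psums 0 η₁ ++_)
    (trans (cong (λ c → psums c η₂) (sym (+-identityʳ n₁))) (psums-+ n₁ 0 η₂)))

  ∈-psums-concat⁻ : ∀ {r} → r ∈ psums 0 (η₁ ++ η₂) → r ∈ psums 0 η₁ ⊎ ∃ λ r′ → r′ ∈ psums 0 η₂ × r ≡ n₁ + r′
  ∈-psums-concat⁻ r∈ with ∈-++⁻ (psums 0 η₁) (subst (_ ∈_) psums-concat r∈)
  ... | inj₁ r∈₁ = inj₁ r∈₁
  ... | inj₂ r∈₂ = inj₂ (∈-map⁻ (n₁ +_) r∈₂)

  ∈-psums-concat⁺ˡ : ∀ {r} → r ∈ psums 0 η₁ → r ∈ psums 0 (η₁ ++ η₂)
  ∈-psums-concat⁺ˡ r∈ = subst (_ ∈_) (sym psums-concat) (∈-++⁺ˡ r∈)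

  ∈-psums-concat⁺ʳ : ∀ {r} → r ∈ psums 0 η₂ → n₁ + r ∈ psums 0 (η₁ ++ η₂)
  ∈-psums-concat⁺ʳ r∈ = subst (_ ∈_) (sym psums-concat) (∈-++⁺ʳ (psums 0 η₁) (∈-map⁺ (n₁ +_) r∈))

  Separated-++ˡ⁻ : ∀ {i j} → j ≤ n₁ → Separated (η₁ ++ η₂) (i , j) → Separated η₁ (i , j)
  Separated-++ˡ⁻ j≤n₁ (r , r∈ , i≤r , r<j) with ∈-psums-concat⁻ r∈
  ... | inj₁ r∈₁              = r , r∈₁ , i≤r , r<j
  ... | inj₂ (r′ , _ , refl) = ⊥-elim (<⇒≱ r<j (≤-trans j≤n₁ (m≤m+n n₁ r′)))

  Separated-++ˡ⁺ : ∀ {p} → Separated η₁ p → Separated (η₁ ++ η₂) p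
  Separated-++ˡ⁺ (r , r∈ , i≤r , r<j) = r , ∈-psums-concat⁺ˡ r∈ , i≤r , r<j

  Separated-++ʳ⁻ : ∀ {i j} → 1 ≤ i → Separated (η₁ ++ η₂) (shift n₁ (i , j)) → Separated η₂ (i , j)
  Separated-++ʳ⁻ 1≤i (r , r∈ , i≤r , r<j) with ∈-psums-concat⁻ r∈
  ... | inj₁ r∈₁                = ⊥-elim (<⇒≱ (<-≤-trans (m<m+n n₁ 1≤i) i≤r) (∈-psums-≤ 0 η₁ r∈₁))
  ... | inj₂ (r′ , r′∈ , refl) = r′ , r′∈ , +-cancelˡ-≤ n₁ _ _ i≤r , +-cancelˡ-< n₁ _ _ r<j

  Separated-++ʳ⁺ : ∀ {p} → Separated η₂ p → Separated (η₁ ++ η₂) (shift n₁ p)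
  Separated-++ʳ⁺ (r , r∈ , i≤r , r<j) = n₁ + r , ∈-psums-concat⁺ʳ r∈ , +-monoʳ-≤ n₁ i≤r , +-monoʳ-< n₁ r<j

  Separated-crossing : ∀ {p} → Crossing n₁ p → Separated (η₁ ++ η₂) p
  Separated-crossing (1≤i , i≤n₁ , n₁<j) = n₁ , ∈-psums-concat⁺ˡ (sum∈psums 0 η₁ (≤-trans 1≤i i≤n₁)) , i≤n₁ , n₁<j

  ∈-crossing⁻ : ∀ {p} → p ∈ crossing → IsPair N p × Crossing n₁ p
  ∈-crossing⁻ p∈ with ∈-filter⁻ (crossing? n₁) {xs = pairs N} p∈
  ... | p∈pairs , cross = ∈-pairs⁻ N p∈pairs , cross

  shifted-above : All (Above n₁) shifted
  shifted-above = Allₚ.map⁺ (All.map (λ (1≤i , i<j , _) → m<m+n n₁ 1≤i , +-monoʳ-< n₁ i<j) (Phi-pairs η₂))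

  IsPair-shift : ∀ {q} → IsPair n₂ q → IsPair N (shift n₁ q)
  IsPair-shift {i , _} (1≤i , i<j , j≤n₂) = ≤-trans 1≤i (m≤n+m i n₁) , +-monoʳ-< n₁ i<j , +-monoʳ-≤ n₁ j≤n₂

  ∈-Phi-++⁻ : ∀ {p} → p ∈ Phi (η₁ ++ η₂) → p ∈ blocks
  ∈-Phi-++⁻ {i , j} p∈ with ∈-Phi⁻ (η₁ ++ η₂) p∈
  ... | pair , sep with subst (λ n → IsPair n (i , j)) (sum-++ η₁ η₂) pair | i ≤? n₁ | j ≤? n₁
  ... | 1≤i , i<j , _ | yes i≤n₁ | yes j≤n₁ =
    ∈-++⁺ʳ crossing (∈-++⁺ˡ (∈-Phi⁺ η₁ (1≤i , i<j , j≤n₁) (Separated-++ˡ⁻ j≤n₁ sep)))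
  ... | pairN | yes i≤n₁ | no j≰n₁ =
    ∈-++⁺ˡ (∈-filter⁺ (crossing? n₁) (∈-pairs⁺ N pairN) (proj₁ pairN , i≤n₁ , ≰⇒> j≰n₁))
  ... | pairN | no i≰n₁ | _
    with m≤n⇒∃[o]m+o≡n (<⇒≤ (≰⇒> i≰n₁)) | m≤n⇒∃[o]m+o≡n (<⇒≤ (<-trans (≰⇒> i≰n₁) (proj₁ (proj₂ pairN))))
  ...   | i′ , refl | j′ , refl =
    ∈-++⁺ʳ crossing (∈-++⁺ʳ (Phi η₁) (∈-map⁺ (shift n₁) (∈-Phi⁺ η₂ pair′ (Separated-++ʳ⁻ 1≤i′ sep))))
    where
    1≤i′ : 1 ≤ i′
    1≤i′ = +-cancelˡ-< n₁ 0 i′ (subst (_< n₁ + i′) (sym (+-identityʳ n₁)) (≰⇒> i≰n₁))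
    pair′ : IsPair n₂ (i′ , j′)
    pair′ = 1≤i′ , +-cancelˡ-< n₁ i′ j′ (proj₁ (proj₂ pairN)) , +-cancelˡ-≤ n₁ j′ n₂ (proj₂ (proj₂ pairN))

  ∈-Phi-++⁺ : ∀ {p} → p ∈ blocks → p ∈ Phi (η₁ ++ η₂)
  ∈-Phi-++⁺ p∈ with ∈-++⁻ crossing p∈
  ... | inj₁ p∈crossing with ∈-crossing⁻ p∈crossing
  ...   | pair , cross = ∈-Phi⁺ (η₁ ++ η₂) (IsPair-N pair) (Separated-crossing cross)
  ∈-Phi-++⁺ p∈ | inj₂ p∈rest with ∈-++⁻ (Phi η₁) p∈rest
  ... | inj₁ p∈Phi₁ with ∈-Phi⁻ η₁ p∈Phi₁
  ...   | (1≤i , i<j , j≤n₁) , sep =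
    ∈-Phi⁺ (η₁ ++ η₂) (IsPair-N (1≤i , i<j , ≤-trans j≤n₁ (m≤m+n n₁ n₂))) (Separated-++ˡ⁺ sep)
  ∈-Phi-++⁺ p∈ | inj₂ p∈rest | inj₂ p∈shifted with ∈-map⁻ (shift n₁) p∈shifted
  ... | q , q∈ , refl with ∈-Phi⁻ η₂ q∈
  ...   | pair , sep = ∈-Phi⁺ (η₁ ++ η₂) (IsPair-N (IsPair-shift pair)) (Separated-++ʳ⁺ sep)

  blocks-unique : Unique blocks
  blocks-unique = Unique.++⁺ (Unique.filter⁺ (crossing? n₁) (pairs-unique N))
    (Unique.++⁺ (Phi-unique η₁) (Unique.map⁺ shift-injective (Phi-unique η₂)) Phi₁-shifted-disjoint)
    crossing-rest-disjoint
    where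
    shift-injective : ∀ {p q} → shift n₁ p ≡ shift n₁ q → p ≡ q
    shift-injective {a , b} {c , d} eq =
      cong₂ _,_ (+-cancelˡ-≡ n₁ a c (cong proj₁ eq)) (+-cancelˡ-≡ n₁ b d (cong proj₂ eq))
    Phi₁-shifted-disjoint : Disjoint (Phi η₁) shifted
    Phi₁-shifted-disjoint (p∈Phi₁ , p∈shifted)
      with All.lookup (Phi-pairs η₁) p∈Phi₁ | All.lookup shifted-above p∈shifted
    ... | _ , i<j , j≤n₁ | n₁<i , _ = <⇒≱ n₁<i (≤-trans (<⇒≤ i<j) j≤n₁)
    crossing-rest-disjoint : Disjoint crossing (Phi η₁ ++ shifted)
    crossing-rest-disjoint (p∈crossing , p∈rest) with proj₂ (∈-crossing⁻ p∈crossing) | ∈-++⁻ (Phi η₁) p∈rest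
    ... | _ , _ , n₁<j | inj₁ p∈Phi₁     = <⇒≱ n₁<j (proj₂ (proj₂ (All.lookup (Phi-pairs η₁) p∈Phi₁)))
    ... | _ , i≤n₁ , _ | inj₂ p∈shifted = <⇒≱ (proj₁ (All.lookup shifted-above p∈shifted)) i≤n₁

  Phi-++-↭ : Phi (η₁ ++ η₂) ↭ blocks
  Phi-++-↭ = same-elements-↭ (Phi-unique (η₁ ++ η₂)) blocks-unique ∈-Phi-++⁻ ∈-Phi-++⁺

  L₁ L₂ Lc : ℕ
  L₁ = length (Phi η₁)
  L₂ = length (Phi η₂)
  Lc = length crossing

  zeros : List ℕ
  zeros = replicate Lc 0

  length-blocks : length blocks ≡ Lc + (L₁ + L₂)
  length-blocks = trans (length-++ crossing)
    (cong (Lc +_) (trans (length-++ (Phi η₁)) (cong (L₁ +_) (length-map (shift n₁) (Phi η₂)))))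

  positions-N-split : ∀ {A : Set} (f : ℕ → A) →
    map f (positions N) ≡ map f (positions n₁) ++ map (f ∘ (n₁ +_)) (positions n₂)
  positions-N-split f = trans (cong (map f) (positions-+ n₁ n₂))
    (trans (map-++ f (positions n₁) _) (cong (map f (positions n₁) ++_) (sym (map-∘ (positions n₂)))))

  crossing-crossing : All (Crossing n₁) crossing
  crossing-crossing = All.tabulate (proj₂ ∘ ∈-crossing⁻)

  rest-balanced : All (Balanced n₁) (Phi η₁ ++ shifted)
  rest-balanced = Allₚ.++⁺ (All.map inj₁ (Phi-pairs η₁)) (All.map inj₂ shifted-above)

  shifted-avoid : ∀ {k} → k ≤ n₁ → All (Avoids k) shifted
  shifted-avoid k≤n₁ = All.map (λ (n₁<i , i<j) → (λ i≡k → <⇒≱ n₁<i (subst (_≤ n₁) (sym i≡k) k≤n₁))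
                                               , (λ j≡k → <⇒≱ (<-trans n₁<i i<j) (subst (_≤ n₁) (sym j≡k) k≤n₁)))
                                shifted-above

  Phi₁-avoid : ∀ {k} → n₁ < k → All (Avoids k) (Phi η₁)
  Phi₁-avoid n₁<k = All.map (λ (_ , i<j , j≤n₁) → (λ i≡k → <⇒≱ n₁<k (subst (_≤ n₁) i≡k (≤-trans (<⇒≤ i<j) j≤n₁)))
                                                , (λ j≡k → <⇒≱ n₁<k (subst (_≤ n₁) j≡k j≤n₁)))
                            (Phi-pairs η₁)

  crossing-exponents-vanish : ∀ γ₁ γ₂ → length γ₁ ≡ n₁ → sumℤ γ₁ ≡ 0ℤ →
    ∀ m → Hits N blocks (γ₁ ++ γ₂) m → All (_≡ 0) (take Lc m)
  crossing-exponents-vanish γ₁ γ₂ |γ₁| Σγ₁ m w≡γ = sum≡0⇒zeros (take Lc m) (ℤ.+-injective (begin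
    ℤ.+ sum (take Lc m)     ≡⟨ ∑pos-net-crossing n₁ crossing (Phi η₁ ++ shifted) m crossing-crossing rest-balanced ⟨
    ∑pos n₁ (net blocks m)  ≡⟨ cong sumℤ first-block ⟩
    sumℤ γ₁                 ≡⟨ Σγ₁ ⟩
    0ℤ                      ∎))
    where
    open ≡-Reasoning
    first-block : map (net blocks m) (positions n₁) ≡ γ₁
    first-block = proj₁ (++-injective _ γ₁ (trans (length-map-positions n₁ _) (sym |γ₁|))
                                          (trans (sym (positions-N-split (net blocks m))) w≡γ))

  weight-blocks : ∀ x y → length x ≡ L₁ →
    map (net blocks (zeros ++ (x ++ y))) (positions N) ≡ weight η₁ x ++ weight η₂ y
  weight-blocks x y |x| = trans (positions-N-split _) (cong₂ _++_
    (map-cong-local (All.map (λ (_ , k≤n₁) → first-block k≤n₁) (positions-bounded n₁)))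
    (map-cong-local (All.map (λ (1≤k , _) → second-block 1≤k) (positions-bounded n₂))))
    where
    open ≡-Reasoning
    net-blocks : ∀ k → net blocks (zeros ++ (x ++ y)) k ≡ net (Phi η₁) x k ℤ.+ net shifted y k
    net-blocks k = trans (net-zeros-++ crossing (Phi η₁ ++ shifted) (x ++ y) k) (net-++ (Phi η₁) shifted x y k |x|)
    first-block : ∀ {k} → k ≤ n₁ → net blocks (zeros ++ (x ++ y)) k ≡ net (Phi η₁) x k
    first-block {k} k≤n₁ = begin
      net blocks (zeros ++ (x ++ y)) k
        ≡⟨ net-blocks k ⟩
      net (Phi η₁) x k ℤ.+ net shifted y k
        ≡⟨ cong (ℤ._+_ (net (Phi η₁) x k)) (net-avoiding shifted y k (shifted-avoid k≤n₁)) ⟩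
      net (Phi η₁) x k ℤ.+ 0ℤ
        ≡⟨ ℤ.+-identityʳ _ ⟩
      net (Phi η₁) x k ∎
    second-block : ∀ {k} → 1 ≤ k → net blocks (zeros ++ (x ++ y)) (n₁ + k) ≡ net (Phi η₂) y k
    second-block {k} 1≤k = begin
      net blocks (zeros ++ (x ++ y)) (n₁ + k)
        ≡⟨ net-blocks (n₁ + k) ⟩
      net (Phi η₁) x (n₁ + k) ℤ.+ net shifted y (n₁ + k)
        ≡⟨ cong₂ ℤ._+_ (net-avoiding (Phi η₁) x (n₁ + k) (Phi₁-avoid (m<m+n n₁ 1≤k))) (net-shift n₁ (Phi η₂) y k) ⟩
      0ℤ ℤ.+ net (Phi η₂) y k
        ≡⟨ ℤ.+-identityˡ _ ⟩
      net (Phi η₂) y k ∎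

  weight-blocks⇔ : ∀ γ₁ γ₂ → length γ₁ ≡ n₁ → ∀ x y → length x ≡ L₁ →
    Hits N blocks (γ₁ ++ γ₂) (zeros ++ (x ++ y)) ⇔ (Hits n₁ (Phi η₁) γ₁ x × Hits n₂ (Phi η₂) γ₂ y)
  weight-blocks⇔ γ₁ γ₂ |γ₁| x y |x| = mk⇔
    (λ w≡γ → ++-injective (weight η₁ x) γ₁ (trans (length-map-positions n₁ _) (sym |γ₁|))
                          (trans (sym (weight-blocks x y |x|)) w≡γ))
    (λ (w₁≡γ₁ , w₂≡γ₂) → trans (weight-blocks x y |x|) (cong₂ _++_ w₁≡γ₁ w₂≡γ₂))

K-++ : ∀ η₁ η₂ γ₁ γ₂ → length γ₁ ≡ sum η₁ → sumℤ γ₁ ≡ 0ℤ →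
  ∀ d → K (η₁ ++ η₂) (γ₁ ++ γ₂) d ≡ conv (K η₁ γ₁) (K η₂ γ₂) d
K-++ η₁ η₂ γ₁ γ₂ |γ₁| Σγ₁ d = begin
  K (η₁ ++ η₂) γ d
    ≡⟨ K≡KΦ (η₁ ++ η₂) γ d ⟩
  KΦ (sum (η₁ ++ η₂)) (Phi (η₁ ++ η₂)) γ d
    ≡⟨ cong (λ n → KΦ n (Phi (η₁ ++ η₂)) γ d) (sum-++ η₁ η₂) ⟩
  KΦ N (Phi (η₁ ++ η₂)) γ d
    ≡⟨ KΦ-↭ N γ Phi-++-↭ d ⟩
  count (hits? N blocks γ) (comps (length blocks) d)
    ≡⟨ cong (count (hits? N blocks γ) ∘ (λ L → comps L d)) length-blocks ⟩
  count (hits? N blocks γ) (comps (Lc + (L₁ + L₂)) d)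
    ≡⟨ count-comps-zero-prefix (hits? N blocks γ) Lc (L₁ + L₂) d (crossing-exponents-vanish γ₁ γ₂ |γ₁| Σγ₁) ⟩
  count (hits? N blocks γ ∘ (zeros ++_)) (comps (L₁ + L₂) d)
    ≡⟨ count-comps-++ (hits? N blocks γ ∘ (zeros ++_)) (hits? n₁ (Phi η₁) γ₁) (hits? n₂ (Phi η₂) γ₂)
                      L₁ L₂ d (weight-blocks⇔ γ₁ γ₂ |γ₁|) ⟩
  ∑< (suc d) (λ c → K η₁ γ₁ c * K η₂ γ₂ (d ∸ c))
    ≡⟨ sum-map-applyUpTo (suc d) (λ c → K η₁ γ₁ c * K η₂ γ₂ (d ∸ c)) id ⟨
  conv (K η₁ γ₁) (K η₂ γ₂) d ∎
  where
  open ≡-Reasoning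
  open Concatenation η₁ η₂
  γ : List ℤ
  γ = γ₁ ++ γ₂

proposition3p5 :
    ((η₁ η₂ : List ℕ) (γ₁ γ₂ : List ℤ) →
      IsComposition η₁ → IsComposition η₂ → InY η₁ γ₁ → InY η₂ γ₂ →
      (d : ℕ) → K (η₁ ++ η₂) (γ₁ ++ γ₂) d ≡ conv (K η₁ γ₁) (K η₂ γ₂) d)
    ×
    ((η : List ℕ) (γ : List ℤ) → IsComposition η → InY η γ →
      (d : ℕ) → K η γ d ≡ K (reverse η) (map -_ (reverse γ)) d)
    ×
    ((η₁ η₂ : List ℕ) (γ : List ℤ) →
      IsComposition η₁ → IsComposition η₂ → sum η₁ ≡ sum η₂ →
      IsSubdivision η₂ η₁ → length γ ≡ sum η₁ → sumℤ γ ≡ Data.Integer.+ 0 →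
      (d : ℕ) → K η₁ γ d ≤ K η₂ γ d)
-- From γ₁ ∈ Y_{η₁} only |γ₁| = |η₁| and Σγ₁ = 0 are needed; (ii) and (iii) hold for every γ.
proposition3p5 =
    (λ η₁ η₂ γ₁ γ₂ _ _ (|γ₁| , Σγ₁ , _) _ → K-++ η₁ η₂ γ₁ γ₂ |γ₁| Σγ₁)
  , (λ η γ _ _ → K-reverse η γ)
  , (λ η₁ η₂ γ η₁⁺ _ η₁≡η₂ η₂⊑η₁ _ _ → K-mono-subdivision η₁ η₂ γ η₁⁺ η₁≡η₂ η₂⊑η₁)
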